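{- Let $X$ be a finite set and $\mathcal{D}\subseteq\mathcal{R}(X)$. The operator assigning to each pair $R,R'\in\mathcal{D}$ the set $[R,R']\cap\mathcal{D}$ is a geometric interval operator on $\mathcal{D}$.
   Context: $\mathcal{R}(X)$ is the set of strict linear orders on $X$. For $R,R'\in\mathcal{R}(X)$ let $[R,R']=\{Q\in\mathcal{R}(X): Q\supseteq R\cap R'\}$. An interval operator on a finite set $V$ assigns to each $(v,w)\in V\times V$ a non-empty set $I(v,w)\subseteq V$ with $v\in I(v,w)$ and $I(v,w)=I(w,v)$; it is geometric if for all $t,u,v,w\in V$: $I(v,v)=\{v\}$; $u\in I(v,w)\Rightarrow I(v,u)\subseteq I(v,w)$; and ($t,u\in I(v,w)$ and $t\in I(v,u)$) $\Rightarrow u\in I(t,w)$. -}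

module Defs where

open import Data.Nat using (ℕ)
open import Data.Fin using (Fin)
open import Data.Bool using (Bool; true)
open import Data.Vec using (Vec; lookup)
open import Data.Product using (_×_; ∃)
open import Data.Sum using (_⊎_)
open import Relation.Binary.PropositionalEquality using (_≡_; _≢_)
open import Relation.Nullary using (¬_)
open import Function.Bundles using (_⇔_)

-- A binary relation on the finite set X = Fin n, stored as its n×n
-- incidence matrix, so that propositional equality is equality of
-- relations as sets of ordered pairs.
BinRel : ℕ → Set
BinRel n = Vec (Vec Bool n) n

_∋⟨_,_⟩ : ∀ {n} → BinRel n → Fin n → Fin n → Set
R ∋⟨ x , y ⟩ = lookup (lookup R x) y ≡ true

-- R is a strict linear order on Fin n (an element of 𝓡(X))
record IsStrictLinearOrder {n : ℕ} (R : BinRel n) : Set where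
  field
    irrefl : ∀ x → ¬ (R ∋⟨ x , x ⟩)
    trans  : ∀ x y z → R ∋⟨ x , y ⟩ → R ∋⟨ y , z ⟩ → R ∋⟨ x , z ⟩
    total  : ∀ x y → x ≢ y → R ∋⟨ x , y ⟩ ⊎ R ∋⟨ y , x ⟩

InInterval : ∀ {n} → BinRel n → BinRel n → BinRel n → Set
InInterval R R' Q =
  IsStrictLinearOrder Q ×
  (∀ x y → R ∋⟨ x , y ⟩ → R' ∋⟨ x , y ⟩ → Q ∋⟨ x , y ⟩)

-- Geometric interval operator on the set V ⊆ A (V given as a predicate),
-- I v w u meaning u ∈ I(v,w).
record IsGeometricIntervalOperator {A : Set} (V : A → Set)
         (I : A → A → A → Set) : Set₁ where
  field
    subset    : ∀ v w u → V v → V w → I v w u → V u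
    nonempty  : ∀ v w → V v → V w → ∃ λ u → I v w u
    contains  : ∀ v w → V v → V w → I v w v
    symmetric : ∀ v w u → V v → V w → (I v w u ⇔ I w v u)
    singleton : ∀ v u → V v → I v v u → u ≡ v
    monotone  : ∀ v w u t → V v → V w → V u → V t →
                I v w u → I v u t → I v w t
    exchange  : ∀ t u v w → V t → V u → V v → V w →
                I v w t → I v w u → I v u t → I t w u

-- 1. On the whole of 𝓡(X) the operator (R , R') ↦ [R , R'] is geometric.
--    Most axioms are immediate from the definition by inclusion; the two
--    with content are
--      * I(R,R) = {R}: a strict linear order contained in another one is
--        equal to it (linear orders are maximal among asymmetric
--        relations), and
--      * the exchange axiom, which is a short case analysis using totality
--        of the base point v and of u together with asymmetry of t.
-- 2. Restricting a geometric interval operator on V to a subset D ⊆ V,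
--    i.e. replacing I(v,w) by I(v,w) ∩ D, again gives a geometric interval
--    operator.
module Submission where

open import Defs
open import Data.Nat using (ℕ)
open import Data.Bool using (Bool; true; false)
open import Data.Fin using (_≟_)
open import Data.Vec using (Vec; lookup)
open import Data.Vec.Properties using (tabulate∘lookup; tabulate-cong)
open import Data.Product using (_×_; _,_; proj₁; proj₂)
open import Data.Product.Function.NonDependent.Propositional using (_×-⇔_)
open import Data.Sum using (inj₁; inj₂)
open import Data.Empty using (⊥-elim)
open import Relation.Nullary using (¬_; yes; no)
open import Relation.Binary.PropositionalEquality using (_≡_; refl; sym; trans)
open import Function.Bundles using (mk⇔)
open import Function.Construct.Identity using (⇔-id)

private
  variable
    n : ℕ
    R R′ Q T U : BinRel n

_⊆_ : BinRel n → BinRel n → Set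
R ⊆ Q = ∀ x y → R ∋⟨ x , y ⟩ → Q ∋⟨ x , y ⟩

vec-ext : ∀ {A : Set} {m} (u v : Vec A m) → (∀ i → lookup u i ≡ lookup v i) → u ≡ v
vec-ext u v same =
  trans (sym (tabulate∘lookup u)) (trans (tabulate-cong same) (tabulate∘lookup v))

bool-ext : ∀ {a b : Bool} → (a ≡ true → b ≡ true) → (b ≡ true → a ≡ true) → a ≡ b
bool-ext {false} {false} _ _ = refl
bool-ext {false} {true}  _ b⇒a = b⇒a refl
bool-ext {true}  {false} a⇒b _ = sym (a⇒b refl)
bool-ext {true}  {true}  _ _ = refl

⊆-antisym : R ⊆ Q → Q ⊆ R → R ≡ Q
⊆-antisym {R = R} {Q = Q} R⊆Q Q⊆R =
  vec-ext R Q λ x → vec-ext (lookup R x) (lookup Q x) λ y →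
    bool-ext (R⊆Q x y) (Q⊆R x y)

asym : IsStrictLinearOrder R → ∀ x y → R ∋⟨ x , y ⟩ → ¬ R ∋⟨ y , x ⟩
asym L x y xy yx = irrefl x (trans′ x y x xy yx)
  where open IsStrictLinearOrder L renaming (trans to trans′)

linear-⊆-equal : IsStrictLinearOrder R → IsStrictLinearOrder Q → R ⊆ Q → R ≡ Q
linear-⊆-equal {R = R} {Q = Q} LR LQ R⊆Q = ⊆-antisym R⊆Q Q⊆R
  where
  Q⊆R : Q ⊆ R
  Q⊆R x y Qxy with x ≟ y
  ... | yes refl = ⊥-elim (IsStrictLinearOrder.irrefl LQ x Qxy)
  ... | no x≢y with IsStrictLinearOrder.total LR x y x≢y
  ...   | inj₁ Rxy = Rxy
  ...   | inj₂ Ryx = ⊥-elim (asym LQ x y Qxy (R⊆Q y x Ryx))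

interval-contains : IsStrictLinearOrder R → InInterval R R′ R
interval-contains L = L , λ x y Rxy _ → Rxy

-- [R , R'] depends only on R ∩ R', hence is symmetric in R and R'.
interval-swap : InInterval R R′ Q → InInterval R′ R Q
interval-swap (L , below) = L , λ x y R′xy Rxy → below x y Rxy R′xy

interval-singleton : IsStrictLinearOrder R → InInterval R R Q → Q ≡ R
interval-singleton LR (LQ , below) =
  sym (linear-⊆-equal LR LQ (λ x y Rxy → below x y Rxy Rxy))

-- U ∈ [R , R'] implies [R , U] ⊆ [R , R'], since R ∩ R' ⊆ R ∩ U.
interval-monotone : InInterval R R′ U → InInterval R U T → InInterval R R′ T
interval-monotone (_ , R∩R′⊆U) (LT , R∩U⊆T) =
  LT , λ x y Rxy R′xy → R∩U⊆T x y Rxy (R∩R′⊆U x y Rxy R′xy)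

-- Given T x y and R' x y: if R x y then U x y as R ∩ R' ⊆ U; otherwise
-- R y x, and U y x would give T y x (as R ∩ U ⊆ T), contradicting T x y.
interval-exchange : IsStrictLinearOrder R →
                    InInterval R R′ U → InInterval R U T → InInterval T R′ U
interval-exchange {R′ = R′} {U = U} {T = T} LR (LU , R∩R′⊆U) (LT , R∩U⊆T) =
  LU , T∩R′⊆U
  where
  T∩R′⊆U : ∀ x y → T ∋⟨ x , y ⟩ → R′ ∋⟨ x , y ⟩ → U ∋⟨ x , y ⟩
  T∩R′⊆U x y Txy R′xy with x ≟ y
  ... | yes refl = ⊥-elim (IsStrictLinearOrder.irrefl LT x Txy)
  ... | no x≢y with IsStrictLinearOrder.total LR x y x≢y
  ...   | inj₁ Rxy = R∩R′⊆U x y Rxy R′xy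
  ...   | inj₂ Ryx with IsStrictLinearOrder.total LU x y x≢y
  ...     | inj₁ Uxy = Uxy
  ...     | inj₂ Uyx = ⊥-elim (asym LT x y Txy (R∩U⊆T y x Ryx Uyx))

intervals-geometric : (n : ℕ) →
  IsGeometricIntervalOperator (IsStrictLinearOrder {n}) InInterval
intervals-geometric n = record
  { subset    = λ _ _ _ _ _ → proj₁
  ; nonempty  = λ v w Lv _ → v , interval-contains {R′ = w} Lv
  ; contains  = λ v w Lv _ → interval-contains {R′ = w} Lv
  ; symmetric = λ v w u _ _ →
      mk⇔ (interval-swap {R = v} {R′ = w} {Q = u})
          (interval-swap {R = w} {R′ = v} {Q = u})
  ; singleton = λ v u Lv → interval-singleton {Q = u} Lv
  ; monotone  = λ v w u t _ _ _ _ →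
      interval-monotone {R = v} {R′ = w} {U = u} {T = t}
  ; exchange  = λ t u v w _ _ Lv _ _ →
      interval-exchange {R′ = w} {U = u} {T = t} Lv
  }

restrict-geometric : ∀ {A : Set} {V D : A → Set} {I : A → A → A → Set} →
  IsGeometricIntervalOperator V I → (∀ a → D a → V a) →
  IsGeometricIntervalOperator D (λ v w u → I v w u × D u)
restrict-geometric {V = V} {D = D} G D⊆V = record
  { subset    = λ _ _ _ _ _ → proj₂
  ; nonempty  = λ v w Dv Dw → v , contains v w (V∋ Dv) (V∋ Dw) , Dv
  ; contains  = λ v w Dv Dw → contains v w (V∋ Dv) (V∋ Dw) , Dv
  ; symmetric = λ v w u Dv Dw →
      symmetric v w u (V∋ Dv) (V∋ Dw) ×-⇔ ⇔-id (D u)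
  ; singleton = λ v u Dv (Ivvu , _) → singleton v u (V∋ Dv) Ivvu
  ; monotone  = λ v w u t Dv Dw Du Dt (Ivwu , _) (Ivut , _) →
      monotone v w u t (V∋ Dv) (V∋ Dw) (V∋ Du) (V∋ Dt) Ivwu Ivut , Dt
  ; exchange  = λ t u v w Dt Du Dv Dw (Ivwt , _) (Ivwu , _) (Ivut , _) →
      exchange t u v w (V∋ Dt) (V∋ Du) (V∋ Dv) (V∋ Dw) Ivwt Ivwu Ivut , Du
  }
  where
  open IsGeometricIntervalOperator G
  V∋ : ∀ {a} → D a → V a
  V∋ {a} = D⊆V a

lemmaA2 : (n : ℕ) (𝓓 : BinRel n → Set) →
    (∀ R → 𝓓 R → IsStrictLinearOrder R) →
    IsGeometricIntervalOperator 𝓓 (λ R R' Q → InInterval R R' Q × 𝓓 Q)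
lemmaA2 n 𝓓 𝓓⊆𝓡 = restrict-geometric (intervals-geometric n) 𝓓⊆𝓡
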